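{- Let $C(a,b)=a^4+22a^2b^2+125b^4$, $A(a,b)=(-3a^4-30a^2b^2-15b^4)C(a,b)$ and $B(a,b)=2(a^4+4a^2b^2-b^4)(a^4+22a^2b^2+125b^4)C(a,b)$. For a prime $\ell$ let \[\mathfrak{d}_\ell:=\ell^{ -12}\,\#\{(a,b)\in(\mathbb{Z}/\ell^6\mathbb{Z})^2:\ (a,b)\not\equiv(0,0)\ (\mathrm{mod}\ \ell),\ \text{and }\big(A(a,b)\not\equiv0\ (\mathrm{mod}\ \ell^4)\text{ or }B(a,b)\not\equiv0\ (\mathrm{mod}\ \ell^6)\big)\}.\] Then for every prime $\ell\notin\{2,3,5\}$, \[\mathfrak{d}_\ell=1-\frac{1}{\ell^2}-\frac{r_\ell(\ell-1)}{\ell^5},\] where $r_\ell$ is the number of $t\in\mathbb{Z}/\ell\mathbb{Z}$ with $t^4+22t^2+125\equiv0\pmod\ell$. -}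

module Defs where

open import Data.Nat as ℕ using (ℕ; NonZero)
open import Data.Nat.Divisibility as ℕD using ()
open import Data.Nat.Properties using (m^n≢0)
open import Data.Nat.Primality using (Prime; prime⇒nonZero)
open import Data.Integer as ℤ using (ℤ; +_)
open import Data.Integer.Divisibility.Signed as ℤD using ()
open import Data.Rational as ℚ using (ℚ)
open import Data.List using (List; upTo; length; filter; cartesianProduct)
open import Data.Product using (_×_; _,_)
open import Data.Sum using (_⊎_)
open import Relation.Nullary using (¬_; Dec)
open import Relation.Nullary.Decidable using (¬?; _×-dec_; _⊎-dec_)

C : ℤ → ℤ → ℤ
C a b = a ℤ.^ 4 ℤ.+ + 22 ℤ.* a ℤ.^ 2 ℤ.* b ℤ.^ 2 ℤ.+ + 125 ℤ.* b ℤ.^ 4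

A : ℤ → ℤ → ℤ
A a b = (ℤ.- (+ 3) ℤ.* a ℤ.^ 4 ℤ.- + 30 ℤ.* a ℤ.^ 2 ℤ.* b ℤ.^ 2 ℤ.- + 15 ℤ.* b ℤ.^ 4) ℤ.* C a b

B : ℤ → ℤ → ℤ
B a b = + 2 ℤ.* (a ℤ.^ 4 ℤ.+ + 4 ℤ.* a ℤ.^ 2 ℤ.* b ℤ.^ 2 ℤ.- b ℤ.^ 4)
          ℤ.* (a ℤ.^ 4 ℤ.+ + 22 ℤ.* a ℤ.^ 2 ℤ.* b ℤ.^ 2 ℤ.+ + 125 ℤ.* b ℤ.^ 4)
          ℤ.* C a b

Good : ℕ → ℕ × ℕ → Set
Good ℓ (a , b) =
  ¬ (ℓ ℕD.∣ a × ℓ ℕD.∣ b) ×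
  (¬ (+ (ℓ ℕ.^ 4) ℤD.∣ A (+ a) (+ b)) ⊎ ¬ (+ (ℓ ℕ.^ 6) ℤD.∣ B (+ a) (+ b)))

good? : ∀ ℓ p → Dec (Good ℓ p)
good? ℓ (a , b) =
  ¬? ((ℓ ℕD.∣? a) ×-dec (ℓ ℕD.∣? b)) ×-dec
  (¬? (+ (ℓ ℕ.^ 4) ℤD.∣? A (+ a) (+ b)) ⊎-dec ¬? (+ (ℓ ℕ.^ 6) ℤD.∣? B (+ a) (+ b)))

-- # of (a,b) ∈ (ℤ/ℓ^6ℤ)², represented by 0 ≤ a,b < ℓ^6, satisfying the condition
goodCount : ℕ → ℕ
goodCount ℓ = length (filter (good? ℓ) (cartesianProduct (upTo (ℓ ℕ.^ 6)) (upTo (ℓ ℕ.^ 6))))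

𝔡 : (ℓ : ℕ) → .{{NonZero ℓ}} → ℚ
𝔡 ℓ = + goodCount ℓ ℚ./ (ℓ ℕ.^ 12)
  where instance _ = m^n≢0 ℓ 12

-- r_ℓ = #{ t ∈ ℤ/ℓℤ : t^4 + 22 t^2 + 125 ≡ 0 mod ℓ }, t represented by 0 ≤ t < ℓ
r : ℕ → ℕ
r ℓ = length (filter (λ t → ℓ ℕD.∣? (t ℕ.^ 4 ℕ.+ 22 ℕ.* t ℕ.^ 2 ℕ.+ 125)) (upTo ℓ))

{-# OPTIONS --safe #-}
module Submission where

-- Write A = −3·D·C and B = 2·E·C² with D = a⁴ + 10a²b² + 5b⁴ and E = a⁴ + 4a²b² − b⁴.
-- For a pair (a, b) not divisible by ℓ, identities of resultant type show that a prime ℓ ∤ 30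
-- dividing D divides neither C nor E; hence "ℓ⁴ ∣ A and ℓ⁶ ∣ B" holds exactly when ℓ⁴ ∣ C.
-- Counting column by column, the pairs that are not counted in 𝔡_ℓ are: for ℓ ∣ b, the ℓ⁵
-- values a ≡ 0; for ℓ ∤ b, the roots of C(·, b) modulo ℓ⁴, repeated ℓ² times below ℓ⁶.
-- These roots are nonsingular, so each root modulo ℓ lifts uniquely (Hensel), and t ↦ t·b
-- matches the roots modulo ℓ with those of t⁴ + 22t² + 125. Thus
-- #good + ℓ⁵·(ℓ⁵ + (ℓ − 1)·ℓ²·r_ℓ) = ℓ¹², which is the claimed value of 𝔡_ℓ.

open import Data.Bool.Base using (true; false; if_then_else_)
open import Data.Fin.Base using (toℕ; fromℕ<)
open import Data.Fin.Permutation using (Permutation; permutation; _⟨$⟩ʳ_)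
open import Data.Fin.Properties using (toℕ<n; toℕ-injective; toℕ-fromℕ<)
open import Data.List.Base using (List; _++_; length; filter; map; applyUpTo; upTo; cartesianProduct)
open import Data.List.Properties using (length-++; filter-++; map-applyUpTo)
open import Data.Nat.Base hiding (_/_)
open import Data.Nat.Coprimality using (Coprime; coprime-Bézout)
open import Data.Nat.Divisibility
open import Data.Nat.DivMod using (_%_; m≡m%n+[m/n]*n; m%n<n; %-distribˡ-*; m%n%n≡m%n; [m+kn]%n≡m%n; m<n⇒m%n≡m)
  renaming (_/_ to _div_)
open import Data.Nat.GCD using (module Bézout)
open import Data.Nat.Primality using (Prime; euclidsLemma; prime⇒irreducible; prime⇒nonZero; prime⇒nonTrivial; prime[2]; prime?)
open import Data.Nat.Properties
open import Algebra.Properties.CommutativeMonoid.Sum +-0-commutativeMonoid using (sum; sum-permute; sum-cong-≗)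
open import Algebra.Properties.CommutativeSemigroup +-commutativeSemigroup using (interchange; x∙yz≈y∙xz)
open import Data.Nat.Solver using (module +-*-Solver)
open import Data.Product using (_×_; _,_; proj₁; proj₂; ∃; ∃₂)
open import Data.Rational as ℚ using (ℚ; _-_; 1ℚ; _/_; toℚᵘ)
open import Data.Rational.Properties using (toℚᵘ-injective; toℚᵘ-fromℚᵘ; toℚᵘ-homo-+; toℚᵘ-homo‿-)
open import Data.Sum using (_⊎_; inj₁; inj₂; [_,_]) renaming (map to map-⊎)
open import Function using (_∘_; id; _⇔_; mk⇔; Equivalence)
open import Level using (Level)
open import Relation.Binary.PropositionalEquality hiding ([_])
open import Relation.Nullary using (Dec; yes; no; ¬_; does; contradiction)
open import Relation.Nullary.Decidable using (does-⇔; dec-true; dec-false; from-yes)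
open import Relation.Unary using (Pred; Decidable)

open import Defs

open Equivalence using (to; from)

module ℤ where
  open import Data.Integer.Base public using (ℤ; +_; _+_; _-_; _*_; -_; _^_)
  open import Data.Integer.Divisibility.Signed public
    using (_∣_; _∣?_; ∣ᵤ⇒∣; ∣⇒∣ᵤ; ∣-trans; ∣m+n∣m⇒∣n; ∣m⇒∣m*n; ∣n⇒∣m*n; *-monoˡ-∣; *-monoʳ-∣)
  open import Data.Integer.Properties public using (abs-*; pos-*)
  open import Data.Integer.Solver public using (module +-*-Solver)

open ℤ using (ℤ; +_)

module ℚᵘ where
  open import Data.Rational.Unnormalised.Base public using (mkℚᵘ; _≃_; *≡*; 1ℚᵘ; _-_; -_)
  open import Data.Rational.Unnormalised.Properties public
    using (≃-trans; +-cong; +-congˡ; +-congʳ; -‿cong; module ≃-Reasoning)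

private
  variable
    a : Level
    P Q : Set a
    m n : ℕ
    f : ℕ → ℕ

𝟙 : Dec P → ℕ
𝟙 P? = if does P? then 1 else 0

𝟙-cong : P ⇔ Q → (P? : Dec P) (Q? : Dec Q) → 𝟙 P? ≡ 𝟙 Q?
𝟙-cong P⇔Q P? Q? = cong (λ b → if b then 1 else 0) (does-⇔ P⇔Q P? Q?)

𝟙-yes : P → (P? : Dec P) → 𝟙 P? ≡ 1
𝟙-yes p P? = cong (λ b → if b then 1 else 0) (dec-true P? p)

𝟙-no : ¬ P → (P? : Dec P) → 𝟙 P? ≡ 0
𝟙-no ¬p P? = cong (λ b → if b then 1 else 0) (dec-false P? ¬p)

𝟙-complement : P ⇔ (¬ Q) → (P? : Dec P) (Q? : Dec Q) → 𝟙 P? + 𝟙 Q? ≡ 1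
𝟙-complement P⇔¬Q P? (yes q) = cong (_+ 1) (𝟙-no (λ p → to P⇔¬Q p q) P?)
𝟙-complement P⇔¬Q P? (no ¬q) = cong (_+ 0) (𝟙-yes (from P⇔¬Q ¬q) P?)

∑ : ℕ → (ℕ → ℕ) → ℕ
∑ zero    f = 0
∑ (suc n) f = f 0 + ∑ n (f ∘ suc)

syntax ∑ n (λ i → e) = ∑[ i < n ] e

∑-cong : ∀ n {f g : ℕ → ℕ} → (∀ i → i < n → f i ≡ g i) → ∑ n f ≡ ∑ n g
∑-cong zero    f≗g = refl
∑-cong (suc n) f≗g = cong₂ _+_ (f≗g 0 z<s) (∑-cong n (λ i i<n → f≗g (suc i) (s<s i<n)))

∑-const : ∀ n c → ∑[ _ < n ] c ≡ n * c
∑-const zero    c = refl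
∑-const (suc n) c = cong (_+_ c) (∑-const n c)

∑-distrib-+ : ∀ n (f g : ℕ → ℕ) → ∑[ i < n ] (f i + g i) ≡ ∑ n f + ∑ n g
∑-distrib-+ zero    f g = refl
∑-distrib-+ (suc n) f g = trans (cong (_+_ (f 0 + g 0)) (∑-distrib-+ n (f ∘ suc) (g ∘ suc)))
                                (interchange (f 0) (g 0) _ _)

∑-++ : ∀ m n f → ∑ (m + n) f ≡ ∑ m f + ∑[ i < n ] f (m + i)
∑-++ zero    n f = refl
∑-++ (suc m) n f = trans (cong (_+_ (f 0)) (∑-++ m n (f ∘ suc))) (sym (+-assoc (f 0) _ _))

∑-last : ∀ n f → ∑ (suc n) f ≡ ∑ n f + f n
∑-last zero    f = +-identityʳ (f 0)
∑-last (suc n) f = trans (cong (_+_ (f 0)) (∑-last n (f ∘ suc))) (sym (+-assoc (f 0) _ _))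

∑-comm : ∀ m n (f : ℕ → ℕ → ℕ) → ∑[ i < m ] ∑[ j < n ] f i j ≡ ∑[ j < n ] ∑[ i < m ] f i j
∑-comm zero    n f = sym (trans (∑-const n 0) (*-zeroʳ n))
∑-comm (suc m) n f = trans (cong (_+_ (∑ n (f 0))) (∑-comm m n (f ∘ suc)))
                           (sym (∑-distrib-+ n (f 0) (λ j → ∑[ i < m ] f (suc i) j)))

∑-* : ∀ m n f → ∑ (m * n) f ≡ ∑[ s < m ] ∑[ u < n ] f (s * n + u)
∑-* zero    n f = refl
∑-* (suc m) n f = trans (∑-++ n (m * n) f) (cong (_+_ (∑ n f)) (trans (∑-* m n (λ i → f (n + i)))
  (∑-cong m (λ s _ → ∑-cong n (λ u _ → cong f (sym (+-assoc n (s * n) u)))))))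

∑-complement : ∀ {R S : ℕ → Set a} n (R? : Decidable R) (S? : Decidable S) →
               (∀ i → R i ⇔ (¬ S i)) → ∑[ i < n ] 𝟙 (R? i) + ∑[ i < n ] 𝟙 (S? i) ≡ n
∑-complement n R? S? R⇔¬S = begin
  ∑[ i < n ] 𝟙 (R? i) + ∑[ i < n ] 𝟙 (S? i)  ≡⟨ ∑-distrib-+ n (𝟙 ∘ R?) (𝟙 ∘ S?) ⟨
  ∑[ i < n ] (𝟙 (R? i) + 𝟙 (S? i))           ≡⟨ ∑-cong n (λ i _ → 𝟙-complement (R⇔¬S i) (R? i) (S? i)) ⟩
  ∑[ i < n ] 1                               ≡⟨ ∑-const n 1 ⟩
  n * 1                                      ≡⟨ *-identityʳ n ⟩
  n                                          ∎
  where
  open ≡-Reasoning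

∑≡sum : ∀ n f → ∑ n f ≡ sum {n} (f ∘ toℕ)
∑≡sum zero    f = refl
∑≡sum (suc n) f = cong (_+_ (f 0)) (∑≡sum n (f ∘ suc))

∑-permute : ∀ n f (σ τ : ℕ → ℕ) →
            (∀ {i} → i < n → σ i < n) → (∀ {i} → i < n → τ i < n) →
            (∀ {i} → i < n → σ (τ i) ≡ i) → (∀ {i} → i < n → τ (σ i) ≡ i) →
            ∑ n f ≡ ∑ n (f ∘ σ)
∑-permute n f σ τ σ< τ< στ τσ = begin
  ∑ n f                         ≡⟨ ∑≡sum n f ⟩
  sum {n} (f ∘ toℕ)             ≡⟨ sum-permute (f ∘ toℕ) π ⟩
  sum {n} (f ∘ toℕ ∘ (π ⟨$⟩ʳ_)) ≡⟨ sum-cong-≗ {n} (λ i → cong f (toℕ-fromℕ< (σ< (toℕ<n i)))) ⟩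
  sum {n} (f ∘ σ ∘ toℕ)         ≡⟨ ∑≡sum n (f ∘ σ) ⟨
  ∑ n (f ∘ σ)                   ∎
  where
  open ≡-Reasoning
  π : Permutation n n
  π = permutation (λ i → fromℕ< (σ< (toℕ<n i))) (λ i → fromℕ< (τ< (toℕ<n i)))
        (λ i → toℕ-injective (trans (toℕ-fromℕ< _) (trans (cong σ (toℕ-fromℕ< _)) (στ (toℕ<n i)))))
        (λ i → toℕ-injective (trans (toℕ-fromℕ< _) (trans (cong τ (toℕ-fromℕ< _)) (τσ (toℕ<n i)))))

Periodic : ℕ → (ℕ → ℕ) → Set
Periodic n f = ∀ x → f (n + x) ≡ f x

periodic-* : Periodic n f → ∀ k x → f (k * n + x) ≡ f x
periodic-*         per zero    x = refl
periodic-* {n} {f} per (suc k) x =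
  trans (cong f (+-assoc n (k * n) x)) (trans (per (k * n + x)) (periodic-* per k x))

periodic-% : .{{_ : NonZero n}} → Periodic n f → ∀ x → f (x % n) ≡ f x
periodic-% {n} {f} per x = sym (begin
  f x                      ≡⟨ cong f (m≡m%n+[m/n]*n x n) ⟩
  f (x % n + x div n * n)  ≡⟨ cong f (+-comm (x % n) _) ⟩
  f (x div n * n + x % n)  ≡⟨ periodic-* per (x div n) (x % n) ⟩
  f (x % n)                ∎)
  where
  open ≡-Reasoning

periodic-shift : Periodic n f → ∀ c → Periodic n (λ i → f (c + i))
periodic-shift {n} {f} per c x = trans (cong f (x∙yz≈y∙xz c n x)) (per (c + x))

periodic-if-∣ : ∀ n {x y} → Periodic n (λ i → if does (n ∣? i) then x else y)
periodic-if-∣ n {x} {y} i = cong (λ b → if b then x else y)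
  (does-⇔ (mk⇔ (λ n∣n+i → ∣m+n∣m⇒∣n n∣n+i ∣-refl) (∣m∣n⇒∣m+n ∣-refl)) (n ∣? (n + i)) (n ∣? i))

∑-periodic : Periodic n f → ∀ k → ∑ (k * n) f ≡ k * ∑ n f
∑-periodic {n} {f} per k = trans (∑-* k n f)
  (trans (∑-cong k (λ s _ → ∑-cong n (λ u _ → periodic-* per s u))) (∑-const k (∑ n f)))

∑-rotate : Periodic n f → ∑ n (f ∘ suc) ≡ ∑ n f
∑-rotate {zero}      per = refl
∑-rotate {suc n} {f} per = begin
  ∑ (suc n) (f ∘ suc)        ≡⟨ ∑-last n (f ∘ suc) ⟩
  ∑ n (f ∘ suc) + f (suc n)  ≡⟨ cong (_+_ (∑ n (f ∘ suc))) (trans (cong f (sym (+-identityʳ (suc n)))) (per 0)) ⟩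
  ∑ n (f ∘ suc) + f 0        ≡⟨ +-comm _ (f 0) ⟩
  f 0 + ∑ n (f ∘ suc)        ∎
  where
  open ≡-Reasoning

∑-shift : Periodic n f → ∀ c → ∑[ i < n ] f (c + i) ≡ ∑ n f
∑-shift         per zero    = refl
∑-shift {n} {f} per (suc c) = begin
  ∑[ i < n ] f (suc c + i)       ≡⟨ ∑-cong n (λ i _ → cong f (sym (+-suc c i))) ⟩
  ∑ n ((λ i → f (c + i)) ∘ suc)  ≡⟨ ∑-rotate {f = λ i → f (c + i)} (periodic-shift per c) ⟩
  ∑[ i < n ] f (c + i)           ≡⟨ ∑-shift per c ⟩
  ∑ n f                          ∎
  where
  open ≡-Reasoning

∑-if-∣ : ∀ n .{{_ : NonZero n}} x y → ∑[ i < n ] (if does (n ∣? i) then x else y) ≡ x + (n ∸ 1) * y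
∑-if-∣ n@(suc m) x y = cong₂ _+_
  (cong (λ b → if b then x else y) (dec-true (n ∣? 0) (n ∣0)))
  (trans (∑-cong m (λ i i<m → cong (λ b → if b then x else y)
                                    (dec-false (n ∣? suc i) (λ n∣1+i → <⇒≱ (s<s i<m) (∣⇒≤ n∣1+i)))))
         (∑-const m y))

length-filter-applyUpTo : ∀ {X : Set} {R : Pred X a} (R? : Decidable R) (g : ℕ → X) n →
                          length (filter R? (applyUpTo g n)) ≡ ∑[ i < n ] 𝟙 (R? (g i))
length-filter-applyUpTo R? g zero = refl
length-filter-applyUpTo R? g (suc n) with does (R? (g 0))
... | true  = cong suc (length-filter-applyUpTo R? (g ∘ suc) n)
... | false = length-filter-applyUpTo R? (g ∘ suc) n

length-filter-cartesianProduct : ∀ {R : Pred (ℕ × ℕ) a} (R? : Decidable R) (g : ℕ → ℕ) n m →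
  length (filter R? (cartesianProduct (applyUpTo g n) (upTo m))) ≡ ∑[ i < n ] ∑[ j < m ] 𝟙 (R? (g i , j))
length-filter-cartesianProduct R? g zero    m = refl
length-filter-cartesianProduct R? g (suc n) m = begin
  length (filter R? (row ++ rows))                     ≡⟨ cong length (filter-++ R? row rows) ⟩
  length (filter R? row ++ filter R? rows)             ≡⟨ length-++ (filter R? row) ⟩
  length (filter R? row) + length (filter R? rows)
    ≡⟨ cong (λ xs → length (filter R? xs) + length (filter R? rows)) (map-applyUpTo id (g 0 ,_) m) ⟩
  length (filter R? (applyUpTo (g 0 ,_) m)) + length (filter R? rows)
    ≡⟨ cong₂ _+_ (length-filter-applyUpTo R? (g 0 ,_) m) (length-filter-cartesianProduct R? (g ∘ suc) n m) ⟩
  ∑[ j < m ] 𝟙 (R? (g 0 , j)) + ∑[ i < n ] ∑[ j < m ] 𝟙 (R? (g (suc i) , j)) ∎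
  where
  open ≡-Reasoning
  row rows : List (ℕ × ℕ)
  row = map (g 0 ,_) (upTo m)
  rows = cartesianProduct (applyUpTo (g ∘ suc) n) (upTo m)

[m%n*o]%n≡[m*o]%n : ∀ m n o .{{_ : NonZero n}} → (m % n * o) % n ≡ (m * o) % n
[m%n*o]%n≡[m*o]%n m n o = begin
  (m % n * o) % n            ≡⟨ %-distribˡ-* (m % n) o n ⟩
  (m % n % n * (o % n)) % n  ≡⟨ cong (λ x → (x * (o % n)) % n) (m%n%n≡m%n m n) ⟩
  (m % n * (o % n)) % n      ≡⟨ %-distribˡ-* m o n ⟨
  (m * o) % n                ∎
  where
  open ≡-Reasoning

inverse-%-cancel : ∀ {b e q n t} .{{_ : NonZero n}} → b * e ≡ 1 + q * n → t < n → (t * b % n * e) % n ≡ t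
inverse-%-cancel {b} {e} {q} {n} {t} be≡1+qn t<n = begin
  (t * b % n * e) % n    ≡⟨ [m%n*o]%n≡[m*o]%n (t * b) n e ⟩
  (t * b * e) % n        ≡⟨ cong (_% n) (trans (*-assoc t b e) (cong (t *_) be≡1+qn)) ⟩
  (t * (1 + q * n)) % n  ≡⟨ cong (_% n) (solve 3 (λ t q n → t :* (con 1 :+ q :* n) := t :+ t :* q :* n) refl t q n) ⟩
  (t + t * q * n) % n    ≡⟨ [m+kn]%n≡m%n t (t * q) n ⟩
  t % n                  ≡⟨ m<n⇒m%n≡m t<n ⟩
  t                      ∎
  where
  open ≡-Reasoning
  open +-*-Solver

module _ {p} (p-prime : Prime p) where

  ∤1 : ¬ p ∣ 1
  ∤1 p∣1 = <⇒≢ (nonTrivial⇒n>1 p {{prime⇒nonTrivial p-prime}}) (sym (∣1⇒≡1 p∣1))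

  ∤-* : ¬ p ∣ m → ¬ p ∣ n → ¬ p ∣ m * n
  ∤-* p∤m p∤n p∣mn = [ p∤m , p∤n ] (euclidsLemma _ _ p-prime p∣mn)

  ∤-^ : ¬ p ∣ m → ∀ k → ¬ p ∣ m ^ k
  ∤-^ p∤m zero    = ∤1
  ∤-^ p∤m (suc k) = ∤-* p∤m (∤-^ p∤m k)

  ∣m*n∧∤m⇒∣n : ¬ p ∣ m → p ∣ m * n → p ∣ n
  ∣m*n∧∤m⇒∣n p∤m p∣mn = [ (λ p∣m → contradiction p∣m p∤m) , id ] (euclidsLemma _ _ p-prime p∣mn)

  ∣m^k⇒∣m : ∀ k → p ∣ m ^ k → p ∣ m
  ∣m^k⇒∣m     zero    p∣1    = contradiction p∣1 ∤1
  ∣m^k⇒∣m {m} (suc k) p∣mᵏ⁺¹ = [ id , ∣m^k⇒∣m k ] (euclidsLemma m (m ^ k) p-prime p∣mᵏ⁺¹)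

  ^∣m*n∧∤m⇒^∣n : ¬ p ∣ m → ∀ k {n} → p ^ k ∣ m * n → p ^ k ∣ n
  ^∣m*n∧∤m⇒^∣n     p∤m zero    _ = 1∣ _
  ^∣m*n∧∤m⇒^∣n {m} p∤m (suc k) pᵏ⁺¹∣mn
    with divides q refl ← ∣m*n∧∤m⇒∣n p∤m (∣-trans (m∣m*n (p ^ k)) pᵏ⁺¹∣mn) =
    subst (_∣ q * p) (*-comm (p ^ k) p) (*-monoˡ-∣ p (^∣m*n∧∤m⇒^∣n p∤m k pᵏ∣mq))
    where
    pᵏ∣mq : p ^ k ∣ m * q
    pᵏ∣mq = *-cancelˡ-∣ p {{prime⇒nonZero p-prime}}
              (subst (p * p ^ k ∣_) (trans (sym (*-assoc m q p)) (*-comm (m * q) p)) pᵏ⁺¹∣mn)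

  ∤⇒coprime : ¬ p ∣ n → Coprime p n
  ∤⇒coprime p∤n (d∣p , d∣n) with prime⇒irreducible p-prime d∣p
  ... | inj₁ d≡1  = d≡1
  ... | inj₂ refl = contradiction d∣n p∤n

  ∣prime⇒≡ : ∀ {q} → Prime q → p ∣ q → p ≡ q
  ∣prime⇒≡ q-prime p∣q = [ (λ p≡1 → contradiction (subst (p ∣_) p≡1 ∣-refl) ∤1) , id ]
                           (prime⇒irreducible q-prime p∣q)

  ℤ-euclid : ∀ x y → + p ℤ.∣ x ℤ.* y → + p ℤ.∣ x ⊎ + p ℤ.∣ y
  ℤ-euclid x y p∣xy = map-⊎ ℤ.∣ᵤ⇒∣ ℤ.∣ᵤ⇒∣
    (euclidsLemma _ _ p-prime (subst (p ∣_) (ℤ.abs-* x y) (ℤ.∣⇒∣ᵤ p∣xy)))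

  ℤ∤-* : ∀ x y → ¬ + p ℤ.∣ x → ¬ + p ℤ.∣ y → ¬ + p ℤ.∣ x ℤ.* y
  ℤ∤-* x y p∤x p∤y p∣xy = [ p∤x , p∤y ] (ℤ-euclid x y p∣xy)

  ℤ∣i^k⇒∣i : ∀ {i} k → + p ℤ.∣ i ℤ.^ k → + p ℤ.∣ i
  ℤ∣i^k⇒∣i     zero    p∣1    = contradiction (ℤ.∣⇒∣ᵤ p∣1) ∤1
  ℤ∣i^k⇒∣i {i} (suc k) p∣iᵏ⁺¹ = [ id , ℤ∣i^k⇒∣i k ] (ℤ-euclid i (i ℤ.^ k) p∣iᵏ⁺¹)

  ℤ∣n*i^k⇒∣i : ¬ p ∣ n → ∀ {i} k → + p ℤ.∣ + n ℤ.* i ℤ.^ k → + p ℤ.∣ i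
  ℤ∣n*i^k⇒∣i {n} p∤n {i} k p∣niᵏ =
    ℤ∣i^k⇒∣i k ([ (λ p∣n → contradiction (ℤ.∣⇒∣ᵤ p∣n) p∤n) , id ] (ℤ-euclid (+ n) (i ℤ.^ k) p∣niᵏ))

  ℤ^∣i*j∧∤i⇒^∣j : ∀ i j → ¬ + p ℤ.∣ i → ∀ k → + (p ^ k) ℤ.∣ i ℤ.* j → + (p ^ k) ℤ.∣ j
  ℤ^∣i*j∧∤i⇒^∣j i j p∤i k pᵏ∣ij = ℤ.∣ᵤ⇒∣
    (^∣m*n∧∤m⇒^∣n (p∤i ∘ ℤ.∣ᵤ⇒∣) k (subst (p ^ k ∣_) (ℤ.abs-* i j) (ℤ.∣⇒∣ᵤ pᵏ∣ij)))

modular-inverse : ∀ {p b} → Prime p → ¬ p ∣ b → ∃₂ λ e q → b * e ≡ 1 + q * p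
modular-inverse {suc (suc m)} {b} p-prime p∤b with coprime-Bézout (∤⇒coprime p-prime p∤b)
... | Bézout.-+ x y 1+xp≡yb = y , x , trans (*-comm b y) (sym 1+xp≡yb)
-- here y·b ≡ −1, so y·(p − 1) inverts b
... | Bézout.+- (suc x) y 1+yb≡[1+x]p = y * suc m , suc m * x + m , (begin
  b * (y * suc m)                    ≡⟨ solve 3 (λ b y m → b :* (y :* m) := m :* (y :* b)) refl b y (suc m) ⟩
  suc m * (y * b)                    ≡⟨ cong (suc m *_) (suc-injective 1+yb≡[1+x]p) ⟩
  suc m * (suc m + x * suc (suc m))  ≡⟨ solve 2 (λ m x → (con 1 :+ m) :* ((con 1 :+ m) :+ x :* (con 2 :+ m))
                                                         := con 1 :+ ((con 1 :+ m) :* x :+ m) :* (con 2 :+ m)) refl m x ⟩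
  1 + (suc m * x + m) * suc (suc m)  ∎)
  where
  open ≡-Reasoning
  open +-*-Solver

module _ {p} (p-prime : Prime p) {d} (p∤d : ¬ p ∣ d) where

  private instance
    p≢0 : NonZero p
    p≢0 = prime⇒nonZero p-prime

  ∑-scale : Periodic p f → ∑[ s < p ] f (s * d) ≡ ∑ p f
  ∑-scale {f} per with e , q , de≡1+qp ← modular-inverse p-prime p∤d = sym (begin
    ∑ p f                     ≡⟨ ∑-permute p f σ τ (λ _ → m%n<n _ p) (λ _ → m%n<n _ p)
                                   (inverse-%-cancel {q = q} (trans (*-comm e d) de≡1+qp))
                                   (inverse-%-cancel {q = q} de≡1+qp) ⟩
    ∑[ s < p ] f (s * d % p)  ≡⟨ ∑-cong p (λ s _ → periodic-% per (s * d)) ⟩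
    ∑[ s < p ] f (s * d)      ∎)
    where
    open ≡-Reasoning
    σ τ : ℕ → ℕ
    σ s = s * d % p
    τ x = x * e % p

  ∑-affine : Periodic p f → ∀ c → ∑[ s < p ] f (c + s * d) ≡ ∑ p f
  ∑-affine per c = trans (∑-scale (periodic-shift per c)) (∑-shift per c)

  linear-congruence-count : ∀ c → ∑[ s < p ] 𝟙 (p ∣? c + s * d) ≡ 1
  linear-congruence-count c = begin
    ∑[ s < p ] 𝟙 (p ∣? c + s * d)  ≡⟨ ∑-affine (periodic-if-∣ p) c ⟩
    ∑[ s < p ] 𝟙 (p ∣? s)          ≡⟨ ∑-if-∣ p 1 0 ⟩
    1 + (p ∸ 1) * 0                ≡⟨ cong suc (*-zeroʳ (p ∸ 1)) ⟩
    1                              ∎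
    where
    open ≡-Reasoning

module HenselCount {p} (p-prime : Prime p) (F F′ : ℕ → ℕ)
                   (taylor : ∀ x u → ∃ λ r → F (x + u) ≡ F u + x * (F′ u + x * r))
                   (nonsingular : ∀ u → p ∣ F u → ¬ p ∣ F′ u) where

  roots : ℕ → ℕ
  roots k = ∑[ a < p ^ k ] 𝟙 (p ^ k ∣? F a)

  ∣F-translate : ∀ {n x} u → n ∣ x → (n ∣ F (x + u)) ⇔ n ∣ F u
  ∣F-translate {n} {x} u n∣x with r , F[x+u]≡ ← taylor x u = mk⇔
    (λ n∣F[x+u] → ∣m+n∣m⇒∣n (subst (n ∣_) (trans F[x+u]≡ (+-comm (F u) _)) n∣F[x+u]) n∣x[F′u+xr])
    (λ n∣Fu → subst (n ∣_) (sym F[x+u]≡) (∣m∣n⇒∣m+n n∣Fu n∣x[F′u+xr]))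
    where
    n∣x[F′u+xr] : n ∣ x * (F′ u + x * r)
    n∣x[F′u+xr] = ∣m⇒∣m*n (F′ u + x * r) n∣x

  periodic-∣F : ∀ n → Periodic n (λ a → 𝟙 (n ∣? F a))
  periodic-∣F n u = 𝟙-cong (∣F-translate u ∣-refl) (n ∣? F (n + u)) (n ∣? F u)

  -- If F u = c·M with M = p^(k+1), then F (s·M + u) ≡ M·(c + s·F′ u) modulo p·M, and since
  -- p ∤ F′ u exactly one digit s < p solves c + s·F′ u ≡ 0 (mod p).
  lift-count : ∀ k u → ∑[ s < p ] 𝟙 (p ^ suc (suc k) ∣? F (s * p ^ suc k + u)) ≡ 𝟙 (p ^ suc k ∣? F u)
  lift-count k u with p ^ suc k ∣? F u
  ... | no M∤Fu = trans (∑-cong p (λ s _ → 𝟙-no (pM∤F[sM+u] s) (p * M ∣? F (s * M + u))))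
                        (trans (∑-const p 0) (*-zeroʳ p))
    where
    M : ℕ
    M = p ^ suc k
    pM∤F[sM+u] : ∀ s → ¬ p * M ∣ F (s * M + u)
    pM∤F[sM+u] s pM∣F = M∤Fu (to (∣F-translate u (n∣m*n s)) (∣-trans (n∣m*n p) pM∣F))
  ... | yes (divides c Fu≡cM) =
    trans (∑-cong p (λ s _ → 𝟙-cong (lift⇔ s) (p * M ∣? F (s * M + u)) (p ∣? c + s * F′ u)))
          (linear-congruence-count p-prime (nonsingular u p∣Fu) c)
    where
    M : ℕ
    M = p ^ suc k
    instance
      M≢0 : NonZero M
      M≢0 = m^n≢0 p (suc k) {{prime⇒nonZero p-prime}}
    p∣Fu : p ∣ F u
    p∣Fu = ∣-trans (m∣m*n (p ^ k)) (divides c Fu≡cM)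
    expand : ∀ s → ∃ λ r → F (s * M + u) ≡ M * (c + s * F′ u) + p * M * r
    expand s with r , F[sM+u]≡ ← taylor (s * M) u = p ^ k * (s * s * r) , (begin
      F (s * M + u)                                       ≡⟨ F[sM+u]≡ ⟩
      F u + s * M * (F′ u + s * M * r)                    ≡⟨ cong (_+ s * M * (F′ u + s * M * r)) Fu≡cM ⟩
      c * M + s * M * (F′ u + s * M * r)                  ≡⟨ solve 6 (λ c s p pᵏ d r →
                                                               c :* (p :* pᵏ) :+ s :* (p :* pᵏ) :* (d :+ s :* (p :* pᵏ) :* r)
                                                            := (p :* pᵏ) :* (c :+ s :* d) :+ p :* (p :* pᵏ) :* (pᵏ :* (s :* s :* r)))
                                                            refl c s p (p ^ k) (F′ u) r ⟩
      M * (c + s * F′ u) + p * M * (p ^ k * (s * s * r))  ∎)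
      where
      open ≡-Reasoning
      open +-*-Solver
    lift⇔ : ∀ s → p * M ∣ F (s * M + u) ⇔ p ∣ c + s * F′ u
    lift⇔ s with r , F[sM+u]≡ ← expand s = mk⇔
      (λ pM∣F → *-cancelˡ-∣ M (subst (_∣ M * (c + s * F′ u)) (*-comm p M)
                  (∣m+n∣m⇒∣n (subst (p * M ∣_) (trans F[sM+u]≡ (+-comm _ (p * M * r))) pM∣F) (m∣m*n r))))
      (λ p∣c+sF′u → subst (p * M ∣_) (sym F[sM+u]≡)
                  (∣m∣n⇒∣m+n (subst (_∣ M * (c + s * F′ u)) (*-comm M p) (*-monoʳ-∣ M p∣c+sF′u)) (m∣m*n r)))

  roots-lift : ∀ k → roots (suc (suc k)) ≡ roots (suc k)
  roots-lift k = begin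
    ∑ (p * M) g                          ≡⟨ ∑-* p M g ⟩
    ∑[ s < p ] ∑[ u < M ] g (s * M + u)  ≡⟨ ∑-comm p M (λ s u → g (s * M + u)) ⟩
    ∑[ u < M ] ∑[ s < p ] g (s * M + u)  ≡⟨ ∑-cong M (λ u _ → lift-count k u) ⟩
    roots (suc k)                        ∎
    where
    open ≡-Reasoning
    M : ℕ
    M = p ^ suc k
    g : ℕ → ℕ
    g a = 𝟙 (p * M ∣? F a)

  roots-stable : ∀ k → roots (suc k) ≡ roots 1
  roots-stable zero    = refl
  roots-stable (suc k) = trans (roots-lift k) (roots-stable k)

  ∑-roots : ∀ j k → ∑[ a < p ^ j * p ^ suc k ] 𝟙 (p ^ suc k ∣? F a) ≡ p ^ j * ∑[ a < p ] 𝟙 (p ∣? F a)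
  ∑-roots j k = begin
    ∑[ a < p ^ j * p ^ suc k ] 𝟙 (p ^ suc k ∣? F a)  ≡⟨ ∑-periodic (periodic-∣F (p ^ suc k)) (p ^ j) ⟩
    p ^ j * roots (suc k)                           ≡⟨ cong (p ^ j *_) (roots-stable k) ⟩
    p ^ j * roots 1                                 ≡⟨ cong (λ n → p ^ j * ∑[ a < n ] 𝟙 (n ∣? F a)) (*-identityʳ p) ⟩
    p ^ j * ∑[ a < p ] 𝟙 (p ∣? F a)                 ∎
    where
    open ≡-Reasoning

-- Stated in the shape to which _≃_ unfolds on the unnormalised fractions in fraction-identity.
cross-multiply : ∀ g s a b → g + b * b + s * (a * b) ≡ a * b * b →
                 + g ℤ.* + (1 * a * b)
                   ≡ ((+ 1 ℤ.* + a ℤ.+ ℤ.- + 1 ℤ.* + 1) ℤ.* + b ℤ.+ ℤ.- + s ℤ.* + (1 * a)) ℤ.* + (a * b * b)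
cross-multiply g s a b eq = begin
  G ℤ.* + (1 * a * b)                       ≡⟨ cong (λ t → G ℤ.* + (t * b)) (*-identityˡ a) ⟩
  G ℤ.* + (a * b)                           ≡⟨ cong (ℤ._*_ G) (ℤ.pos-* a b) ⟩
  G ℤ.* (X ℤ.* Y)                           ≡⟨ solve 4 (λ G S X Y → G :* (X :* Y)
                                                 := R S X Y :* (X :* Y :* Y) :+ X :* Y :* (G :+ Y :* Y :+ S :* (X :* Y) :- X :* Y :* Y))
                                                 refl G S X Y ⟩
  R′ ℤ.* XYY ℤ.+ X ℤ.* Y ℤ.* (G ℤ.+ Y ℤ.* Y ℤ.+ S ℤ.* (X ℤ.* Y) ℤ.- XYY)
                                            ≡⟨ cong (λ t → R′ ℤ.* XYY ℤ.+ X ℤ.* Y ℤ.* (t ℤ.- XYY)) eqℤ ⟩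
  R′ ℤ.* XYY ℤ.+ X ℤ.* Y ℤ.* (XYY ℤ.- XYY)  ≡⟨ solve 3 (λ S X Y → R S X Y :* (X :* Y :* Y) :+ X :* Y :* (X :* Y :* Y :- X :* Y :* Y)
                                                 := R S X Y :* (X :* Y :* Y)) refl S X Y ⟩
  R′ ℤ.* XYY                                ≡⟨ cong₂ (λ t u → ((+ 1 ℤ.* X ℤ.+ ℤ.- + 1 ℤ.* + 1) ℤ.* Y ℤ.+ ℤ.- S ℤ.* + t) ℤ.* u)
                                                     (sym (*-identityˡ a)) (sym XYY≡) ⟩
  ((+ 1 ℤ.* X ℤ.+ ℤ.- + 1 ℤ.* + 1) ℤ.* Y ℤ.+ ℤ.- S ℤ.* + (1 * a)) ℤ.* + (a * b * b) ∎
  where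
  open ≡-Reasoning
  open ℤ.+-*-Solver
  G S X Y XYY R′ : ℤ
  G = + g
  S = + s
  X = + a
  Y = + b
  XYY = X ℤ.* Y ℤ.* Y
  R′ = (+ 1 ℤ.* X ℤ.+ ℤ.- + 1 ℤ.* + 1) ℤ.* Y ℤ.+ ℤ.- S ℤ.* X
  R : ∀ {k} → Polynomial k → Polynomial k → Polynomial k → Polynomial k
  R S X Y = (con (+ 1) :* X :+ :- con (+ 1) :* con (+ 1)) :* Y :+ :- S :* X
  XYY≡ : + (a * b * b) ≡ XYY
  XYY≡ = trans (ℤ.pos-* (a * b) b) (cong (ℤ._* Y) (ℤ.pos-* a b))
  eqℤ : G ℤ.+ Y ℤ.* Y ℤ.+ S ℤ.* (X ℤ.* Y) ≡ XYY
  eqℤ = begin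
    G ℤ.+ Y ℤ.* Y ℤ.+ S ℤ.* (X ℤ.* Y)  ≡⟨ cong₂ (λ x y → G ℤ.+ x ℤ.+ y) (ℤ.pos-* b b)
                                                  (trans (ℤ.pos-* s (a * b)) (cong (ℤ._*_ S) (ℤ.pos-* a b))) ⟨
    + (g + b * b + s * (a * b))         ≡⟨ cong +_ eq ⟩
    + (a * b * b)                       ≡⟨ XYY≡ ⟩
    XYY                                 ∎

toℚᵘ-homo-difference : ∀ p q → toℚᵘ (p - q) ℚᵘ.≃ toℚᵘ p ℚᵘ.- toℚᵘ q
toℚᵘ-homo-difference p q = ℚᵘ.≃-trans (toℚᵘ-homo-+ p (ℚ.- q)) (ℚᵘ.+-congʳ (toℚᵘ p) (toℚᵘ-homo‿- q))

fraction-identity : ∀ g s a b n .{{_ : NonZero a}} .{{_ : NonZero b}} .{{_ : NonZero n}} →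
                    n ≡ a * b * b → g + b * b + s * (a * b) ≡ n → + g / n ≡ 1ℚ - + 1 / a - + s / b
fraction-identity g s a@(suc a-1) b@(suc b-1) .(a * b * b) refl eq = toℚᵘ-injective (begin
  toℚᵘ (+ g / (a * b * b))
    ≈⟨ toℚᵘ-fromℚᵘ (ℚᵘ.mkℚᵘ (+ g) (pred (a * b * b))) ⟩
  ℚᵘ.mkℚᵘ (+ g) (pred (a * b * b))
    ≈⟨ ℚᵘ.*≡* (cross-multiply g s a b eq) ⟩
  ℚᵘ.1ℚᵘ ℚᵘ.- ℚᵘ.mkℚᵘ (+ 1) a-1 ℚᵘ.- ℚᵘ.mkℚᵘ (+ s) b-1
    ≈⟨ ℚᵘ.+-cong (ℚᵘ.+-cong (toℚᵘ-fromℚᵘ ℚᵘ.1ℚᵘ) (ℚᵘ.-‿cong (toℚᵘ-fromℚᵘ (ℚᵘ.mkℚᵘ (+ 1) a-1))))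
                 (ℚᵘ.-‿cong (toℚᵘ-fromℚᵘ (ℚᵘ.mkℚᵘ (+ s) b-1))) ⟨
  toℚᵘ 1ℚ ℚᵘ.- toℚᵘ (+ 1 / a) ℚᵘ.- toℚᵘ (+ s / b)
    ≈⟨ ℚᵘ.+-congˡ (ℚᵘ.- toℚᵘ (+ s / b)) (toℚᵘ-homo-difference 1ℚ (+ 1 / a)) ⟨
  toℚᵘ (1ℚ - + 1 / a) ℚᵘ.- toℚᵘ (+ s / b)
    ≈⟨ toℚᵘ-homo-difference (1ℚ - + 1 / a) (+ s / b) ⟨
  toℚᵘ (1ℚ - + 1 / a - + s / b)
    ∎)
  where
  open ℚᵘ.≃-Reasoning

D E : ℤ → ℤ → ℤ
D i j = i ℤ.^ 4 ℤ.+ + 10 ℤ.* i ℤ.^ 2 ℤ.* j ℤ.^ 2 ℤ.+ + 5 ℤ.* j ℤ.^ 4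
E i j = i ℤ.^ 4 ℤ.+ + 4 ℤ.* i ℤ.^ 2 ℤ.* j ℤ.^ 2 ℤ.- j ℤ.^ 4

module _ (i j : ℤ) where
  open ℤ.+-*-Solver

  B-factor : B i j ≡ + 2 ℤ.* E i j ℤ.* C i j ℤ.* C i j
  B-factor = refl

  A-factor : A i j ≡ ℤ.- (+ 3) ℤ.* D i j ℤ.* C i j
  A-factor = solve 2 (λ i j →
      (:- con (+ 3) :* i :^ 4 :- con (+ 30) :* i :^ 2 :* j :^ 2 :- con (+ 15) :* j :^ 4)
        :* (i :^ 4 :+ con (+ 22) :* i :^ 2 :* j :^ 2 :+ con (+ 125) :* j :^ 4)
    := :- con (+ 3) :* (i :^ 4 :+ con (+ 10) :* i :^ 2 :* j :^ 2 :+ con (+ 5) :* j :^ 4)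
        :* (i :^ 4 :+ con (+ 22) :* i :^ 2 :* j :^ 2 :+ con (+ 125) :* j :^ 4)) refl i j

  D-mod-j : D i j ≡ j ℤ.* (+ 10 ℤ.* i ℤ.^ 2 ℤ.* j ℤ.+ + 5 ℤ.* j ℤ.^ 3) ℤ.+ i ℤ.^ 4
  D-mod-j = solve 2 (λ i j →
      i :^ 4 :+ con (+ 10) :* i :^ 2 :* j :^ 2 :+ con (+ 5) :* j :^ 4
    := j :* (con (+ 10) :* i :^ 2 :* j :+ con (+ 5) :* j :^ 3) :+ i :^ 4) refl i j

  C-D-resultant : (i ℤ.^ 2 ℤ.+ + 12 ℤ.* j ℤ.^ 2) ℤ.* D i j ≡ C i j ℤ.* i ℤ.^ 2 ℤ.+ + 60 ℤ.* j ℤ.^ 6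
  C-D-resultant = solve 2 (λ i j →
      (i :^ 2 :+ con (+ 12) :* j :^ 2) :* (i :^ 4 :+ con (+ 10) :* i :^ 2 :* j :^ 2 :+ con (+ 5) :* j :^ 4)
    := (i :^ 4 :+ con (+ 22) :* i :^ 2 :* j :^ 2 :+ con (+ 125) :* j :^ 4) :* i :^ 2 :+ con (+ 60) :* j :^ 6) refl i j

  E-D-resultant : (i ℤ.^ 2 ℤ.+ + 3 ℤ.* j ℤ.^ 2) ℤ.* D i j ≡ E i j ℤ.* (i ℤ.^ 2 ℤ.+ + 9 ℤ.* j ℤ.^ 2) ℤ.+ + 24 ℤ.* j ℤ.^ 6
  E-D-resultant = solve 2 (λ i j →
      (i :^ 2 :+ con (+ 3) :* j :^ 2) :* (i :^ 4 :+ con (+ 10) :* i :^ 2 :* j :^ 2 :+ con (+ 5) :* j :^ 4)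
    := (i :^ 4 :+ con (+ 4) :* i :^ 2 :* j :^ 2 :- j :^ 4) :* (i :^ 2 :+ con (+ 9) :* j :^ 2) :+ con (+ 24) :* j :^ 6)
    refl i j

Cℕ : ℕ → ℕ → ℕ
Cℕ a b = a ^ 4 + 22 * a ^ 2 * b ^ 2 + 125 * b ^ 4

∂Cℕ : ℕ → ℕ → ℕ
∂Cℕ u b = 4 * u ^ 3 + 44 * u * b ^ 2

C₁ : ℕ → ℕ
C₁ t = t ^ 4 + 22 * t ^ 2 + 125

pos-^ : ∀ m k → + (m ^ k) ≡ (+ m) ℤ.^ k
pos-^ m zero    = refl
pos-^ m (suc k) = trans (ℤ.pos-* m (m ^ k)) (cong (ℤ._*_ (+ m)) (pos-^ m k))

C-pos : ∀ a b → C (+ a) (+ b) ≡ + Cℕ a b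
C-pos a b = sym (cong₂ ℤ._+_ (cong₂ ℤ._+_ (pos-^ a 4) middle) last)
  where
  middle : + (22 * a ^ 2 * b ^ 2) ≡ + 22 ℤ.* (+ a) ℤ.^ 2 ℤ.* (+ b) ℤ.^ 2
  middle = trans (ℤ.pos-* (22 * a ^ 2) (b ^ 2))
                 (cong₂ ℤ._*_ (trans (ℤ.pos-* 22 (a ^ 2)) (cong (ℤ._*_ (+ 22)) (pos-^ a 2))) (pos-^ b 2))
  last : + (125 * b ^ 4) ≡ + 125 ℤ.* (+ b) ℤ.^ 4
  last = trans (ℤ.pos-* 125 (b ^ 4)) (cong (ℤ._*_ (+ 125)) (pos-^ b 4))

module _ where
  open +-*-Solver

  Cℕ-taylor : ∀ b x u → ∃ λ r → Cℕ (x + u) b ≡ Cℕ u b + x * (∂Cℕ u b + x * r)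
  Cℕ-taylor b x u = 6 * u ^ 2 + 4 * u * x + x * x + 22 * b ^ 2 , solve 3 (λ x u b →
      (x :+ u) :^ 4 :+ con 22 :* (x :+ u) :^ 2 :* b :^ 2 :+ con 125 :* b :^ 4
    := u :^ 4 :+ con 22 :* u :^ 2 :* b :^ 2 :+ con 125 :* b :^ 4
       :+ x :* (con 4 :* u :^ 3 :+ con 44 :* u :* b :^ 2
                :+ x :* (con 6 :* u :^ 2 :+ con 4 :* u :* x :+ x :* x :+ con 22 :* b :^ 2))) refl x u b

  Cℕ-dehomogenise : ∀ t b → Cℕ (t * b) b ≡ b ^ 4 * C₁ t
  Cℕ-dehomogenise = solve 2 (λ t b →
      (t :* b) :^ 4 :+ con 22 :* (t :* b) :^ 2 :* b :^ 2 :+ con 125 :* b :^ 4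
    := b :^ 4 :* (t :^ 4 :+ con 22 :* t :^ 2 :+ con 125)) refl

  Cℕ-mod-b : ∀ a b → Cℕ a b ≡ b * (22 * a ^ 2 * b + 125 * b ^ 3) + a ^ 4
  Cℕ-mod-b = solve 2 (λ a b →
      a :^ 4 :+ con 22 :* a :^ 2 :* b :^ 2 :+ con 125 :* b :^ 4
    := b :* (con 22 :* a :^ 2 :* b :+ con 125 :* b :^ 3) :+ a :^ 4) refl

  Cℕ-mod-u : ∀ u b → Cℕ u b ≡ u * (u ^ 3 + 22 * u * b ^ 2) + 125 * b ^ 4
  Cℕ-mod-u = solve 2 (λ u b →
      u :^ 4 :+ con 22 :* u :^ 2 :* b :^ 2 :+ con 125 :* b :^ 4
    := u :* (u :^ 3 :+ con 22 :* u :* b :^ 2) :+ con 125 :* b :^ 4) refl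

  Cℕ-mod-w : ∀ u b → Cℕ u b ≡ (u ^ 2 + 11 * b ^ 2) * (u ^ 2 + 11 * b ^ 2) + 4 * b ^ 4
  Cℕ-mod-w = solve 2 (λ u b →
      u :^ 4 :+ con 22 :* u :^ 2 :* b :^ 2 :+ con 125 :* b :^ 4
    := (u :^ 2 :+ con 11 :* b :^ 2) :* (u :^ 2 :+ con 11 :* b :^ 2) :+ con 4 :* b :^ 4) refl

  ∂Cℕ-factor : ∀ u b → ∂Cℕ u b ≡ 4 * (u * (u ^ 2 + 11 * b ^ 2))
  ∂Cℕ-factor = solve 2 (λ u b →
      con 4 :* u :^ 3 :+ con 44 :* u :* b :^ 2 := con 4 :* (u :* (u :^ 2 :+ con 11 :* b :^ 2))) refl

module _ {ℓ} (ℓ-prime : Prime ℓ) (ℓ∤2 : ¬ ℓ ∣ 2) (ℓ∤3 : ¬ ℓ ∣ 3) (ℓ∤5 : ¬ ℓ ∣ 5) where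

  private instance
    ℓ≢0 : NonZero ℓ
    ℓ≢0 = prime⇒nonZero ℓ-prime

  ∤-smooth : ∀ i j k → ¬ ℓ ∣ 2 ^ i * 3 ^ j * 5 ^ k
  ∤-smooth i j k = ∤-* ℓ-prime (∤-* ℓ-prime (∤-^ ℓ-prime ℓ∤2 i) (∤-^ ℓ-prime ℓ∤3 j)) (∤-^ ℓ-prime ℓ∤5 k)

  Cℕ-nonsingular : ∀ {b} → ¬ ℓ ∣ b → ∀ u → ℓ ∣ Cℕ u b → ¬ ℓ ∣ ∂Cℕ u b
  Cℕ-nonsingular {b} ℓ∤b u ℓ∣C ℓ∣∂C =
    [ ∤-of (Cℕ-mod-u u b) (∤-smooth 0 0 3) , ∤-of (Cℕ-mod-w u b) (∤-smooth 2 0 0) ]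
      (euclidsLemma u _ ℓ-prime (∣m*n∧∤m⇒∣n ℓ-prime (∤-smooth 2 0 0) (subst (ℓ ∣_) (∂Cℕ-factor u b) ℓ∣∂C)))
    where
    ∤-of : ∀ {x q n} → Cℕ u b ≡ x * q + n * b ^ 4 → ¬ ℓ ∣ n → ¬ ℓ ∣ x
    ∤-of {q = q} C≡xq+nb⁴ ℓ∤n ℓ∣x = ℓ∤b (∣m^k⇒∣m ℓ-prime 4 (∣m*n∧∤m⇒∣n ℓ-prime ℓ∤n
      (∣m+n∣m⇒∣n (subst (ℓ ∣_) C≡xq+nb⁴ ℓ∣C) (∣m⇒∣m*n q ℓ∣x))))

  module _ {b} (ℓ∤b : ¬ ℓ ∣ b) where
    open HenselCount ℓ-prime (λ a → Cℕ a b) (λ a → ∂Cℕ a b) (Cℕ-taylor b) (Cℕ-nonsingular ℓ∤b)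

    roots-mod-ℓ : ∑[ a < ℓ ] 𝟙 (ℓ ∣? Cℕ a b) ≡ r ℓ
    roots-mod-ℓ = begin
      ∑[ a < ℓ ] 𝟙 (ℓ ∣? Cℕ a b)        ≡⟨ ∑-scale ℓ-prime ℓ∤b (periodic-∣F ℓ) ⟨
      ∑[ t < ℓ ] 𝟙 (ℓ ∣? Cℕ (t * b) b)  ≡⟨ ∑-cong ℓ (λ t _ → 𝟙-cong (dehomogenise⇔ t) (ℓ ∣? Cℕ (t * b) b) (ℓ ∣? C₁ t)) ⟩
      ∑[ t < ℓ ] 𝟙 (ℓ ∣? C₁ t)          ≡⟨ length-filter-applyUpTo (λ t → ℓ ∣? C₁ t) id ℓ ⟨
      r ℓ                               ∎
      where
      open ≡-Reasoning
      dehomogenise⇔ : ∀ t → ℓ ∣ Cℕ (t * b) b ⇔ ℓ ∣ C₁ t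
      dehomogenise⇔ t = mk⇔
        (λ ℓ∣C → ∣m*n∧∤m⇒∣n ℓ-prime (∤-^ ℓ-prime ℓ∤b 4) (subst (ℓ ∣_) (Cℕ-dehomogenise t b) ℓ∣C))
        (λ ℓ∣C₁ → subst (ℓ ∣_) (sym (Cℕ-dehomogenise t b)) (∣n⇒∣m*n (b ^ 4) ℓ∣C₁))

    C-root-count : ∑[ a < ℓ ^ 6 ] 𝟙 (ℓ ^ 4 ∣? Cℕ a b) ≡ ℓ ^ 2 * r ℓ
    C-root-count = begin
      ∑[ a < ℓ ^ 6 ] 𝟙 (ℓ ^ 4 ∣? Cℕ a b)          ≡⟨ cong (λ n → ∑[ a < n ] 𝟙 (ℓ ^ 4 ∣? Cℕ a b)) (^-distribˡ-+-* ℓ 2 4) ⟩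
      ∑[ a < ℓ ^ 2 * ℓ ^ 4 ] 𝟙 (ℓ ^ 4 ∣? Cℕ a b)  ≡⟨ ∑-roots 2 3 ⟩
      ℓ ^ 2 * ∑[ a < ℓ ] 𝟙 (ℓ ∣? Cℕ a b)          ≡⟨ cong (ℓ ^ 2 *_) roots-mod-ℓ ⟩
      ℓ ^ 2 * r ℓ                                 ∎
      where
      open ≡-Reasoning

  module _ {a b} (prim : ¬ (ℓ ∣ a × ℓ ∣ b)) where

    private
      i j : ℤ
      i = + a
      j = + b

    ℓ∣D⇒ℓ∤j : + ℓ ℤ.∣ D i j → ¬ + ℓ ℤ.∣ j
    ℓ∣D⇒ℓ∤j ℓ∣D ℓ∣j = prim (ℤ.∣⇒∣ᵤ ℓ∣i , ℤ.∣⇒∣ᵤ ℓ∣j)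
      where
      ℓ∣i : + ℓ ℤ.∣ i
      ℓ∣i = ℤ∣i^k⇒∣i ℓ-prime 4 (ℤ.∣m+n∣m⇒∣n (subst (+ ℓ ℤ.∣_) (D-mod-j i j) ℓ∣D) (ℤ.∣m⇒∣m*n _ ℓ∣j))

    -- A common prime factor of D and F would divide n·b⁶, hence b, hence a.
    resultant⇒ℓ∤ : ∀ u v {F} n → u ℤ.* D i j ≡ F ℤ.* v ℤ.+ + n ℤ.* j ℤ.^ 6 → ¬ ℓ ∣ n →
                   + ℓ ℤ.∣ D i j → ¬ + ℓ ℤ.∣ F
    resultant⇒ℓ∤ u v n uD≡Fv+nj⁶ ℓ∤n ℓ∣D ℓ∣F = ℓ∣D⇒ℓ∤j ℓ∣D (ℤ∣n*i^k⇒∣i ℓ-prime ℓ∤n 6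
      (ℤ.∣m+n∣m⇒∣n (subst (+ ℓ ℤ.∣_) uD≡Fv+nj⁶ (ℤ.∣n⇒∣m*n u ℓ∣D)) (ℤ.∣m⇒∣m*n v ℓ∣F)))

    ℓ∣D⇒ℓ∤C : + ℓ ℤ.∣ D i j → ¬ + ℓ ℤ.∣ C i j
    ℓ∣D⇒ℓ∤C = resultant⇒ℓ∤ (i ℤ.^ 2 ℤ.+ + 12 ℤ.* j ℤ.^ 2) (i ℤ.^ 2) 60 (C-D-resultant i j) (∤-smooth 2 1 1)

    ℓ∣D⇒ℓ∤E : + ℓ ℤ.∣ D i j → ¬ + ℓ ℤ.∣ E i j
    ℓ∣D⇒ℓ∤E = resultant⇒ℓ∤ (i ℤ.^ 2 ℤ.+ + 3 ℤ.* j ℤ.^ 2) (i ℤ.^ 2 ℤ.+ + 9 ℤ.* j ℤ.^ 2) 24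
                (E-D-resultant i j) (∤-smooth 3 1 0)

    AB⇒C : + (ℓ ^ 4) ℤ.∣ A i j → + (ℓ ^ 6) ℤ.∣ B i j → + (ℓ ^ 4) ℤ.∣ C i j
    AB⇒C ℓ⁴∣A ℓ⁶∣B with + ℓ ℤ.∣? D i j
    ... | yes ℓ∣D = contradiction (ℤ.∣-trans (ℤ.∣ᵤ⇒∣ (m∣m*n (ℓ ^ 5))) ℓ⁶∣B) ℓ∤B
      where
      ℓ∤C : ¬ + ℓ ℤ.∣ C i j
      ℓ∤C = ℓ∣D⇒ℓ∤C ℓ∣D
      ℓ∤B : ¬ + ℓ ℤ.∣ B i j
      ℓ∤B = subst (λ x → ¬ + ℓ ℤ.∣ x) (sym (B-factor i j))
        (ℤ∤-* ℓ-prime _ (C i j)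
          (ℤ∤-* ℓ-prime _ (C i j) (ℤ∤-* ℓ-prime (+ 2) (E i j) (ℓ∤2 ∘ ℤ.∣⇒∣ᵤ) (ℓ∣D⇒ℓ∤E ℓ∣D)) ℓ∤C) ℓ∤C)
    ... | no ℓ∤D = ℤ^∣i*j∧∤i⇒^∣j ℓ-prime (ℤ.- (+ 3) ℤ.* D i j) (C i j)
                     (ℤ∤-* ℓ-prime (ℤ.- (+ 3)) (D i j) (ℓ∤3 ∘ ℤ.∣⇒∣ᵤ) ℓ∤D) 4
                     (subst (+ (ℓ ^ 4) ℤ.∣_) (A-factor i j) ℓ⁴∣A)

    C⇒AB : + (ℓ ^ 4) ℤ.∣ C i j → + (ℓ ^ 4) ℤ.∣ A i j × + (ℓ ^ 6) ℤ.∣ B i j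
    C⇒AB ℓ⁴∣C = subst (+ (ℓ ^ 4) ℤ.∣_) (sym (A-factor i j)) (ℤ.∣n⇒∣m*n (ℤ.- (+ 3) ℤ.* D i j) ℓ⁴∣C)
              , subst₂ ℤ._∣_ ℓ²ℓ⁴≡ℓ⁶ (sym (B-factor i j))
                  (ℤ.∣-trans (ℤ.*-monoˡ-∣ (+ (ℓ ^ 4)) (ℤ.∣n⇒∣m*n (+ 2 ℤ.* E i j) ℓ²∣C))
                             (ℤ.*-monoʳ-∣ (+ 2 ℤ.* E i j ℤ.* C i j) ℓ⁴∣C))
      where
      ℓ²∣C : + (ℓ ^ 2) ℤ.∣ C i j
      ℓ²∣C = ℤ.∣-trans (ℤ.∣ᵤ⇒∣ (subst (ℓ ^ 2 ∣_) (sym (^-distribˡ-+-* ℓ 2 2)) (m∣m*n (ℓ ^ 2)))) ℓ⁴∣C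
      ℓ²ℓ⁴≡ℓ⁶ : + (ℓ ^ 2) ℤ.* + (ℓ ^ 4) ≡ + (ℓ ^ 6)
      ℓ²ℓ⁴≡ℓ⁶ = trans (sym (ℤ.pos-* (ℓ ^ 2) (ℓ ^ 4))) (cong +_ (sym (^-distribˡ-+-* ℓ 2 4)))

  C-cast : ∀ a b → + (ℓ ^ 4) ℤ.∣ C (+ a) (+ b) ⇔ ℓ ^ 4 ∣ Cℕ a b
  C-cast a b = mk⇔ (λ h → ℤ.∣⇒∣ᵤ (subst (+ (ℓ ^ 4) ℤ.∣_) (C-pos a b) h))
                   (λ h → subst (+ (ℓ ^ 4) ℤ.∣_) (sym (C-pos a b)) (ℤ.∣ᵤ⇒∣ h))

  good⇔ : ∀ {a b} → Good ℓ (a , b) ⇔ (¬ (ℓ ∣ a × ℓ ∣ b) × ¬ ℓ ^ 4 ∣ Cℕ a b)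
  good⇔ {a} {b} = mk⇔
    (λ (prim , ¬A⊎¬B) → prim , λ ℓ⁴∣C → let ℓ⁴∣A , ℓ⁶∣B = C⇒AB prim (from (C-cast a b) ℓ⁴∣C) in
                                         [ (λ ¬A → ¬A ℓ⁴∣A) , (λ ¬B → ¬B ℓ⁶∣B) ] ¬A⊎¬B)
    (λ (prim , ¬C) → prim , ¬A⊎¬B prim ¬C)
    where
    ¬A⊎¬B : ¬ (ℓ ∣ a × ℓ ∣ b) → ¬ ℓ ^ 4 ∣ Cℕ a b →
            ¬ + (ℓ ^ 4) ℤ.∣ A (+ a) (+ b) ⊎ ¬ + (ℓ ^ 6) ℤ.∣ B (+ a) (+ b)
    ¬A⊎¬B prim ¬C with + (ℓ ^ 4) ℤ.∣? A (+ a) (+ b) | + (ℓ ^ 6) ℤ.∣? B (+ a) (+ b)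
    ... | no ¬A  | _      = inj₁ ¬A
    ... | yes _  | no ¬B  = inj₂ ¬B
    ... | yes ℓ⁴∣A | yes ℓ⁶∣B = contradiction (to (C-cast a b) (AB⇒C prim ℓ⁴∣A ℓ⁶∣B)) ¬C

  good⇔ℓ∤a : ∀ {a b} → ℓ ∣ b → Good ℓ (a , b) ⇔ (¬ ℓ ∣ a)
  good⇔ℓ∤a {a} {b} ℓ∣b = mk⇔
    (λ good ℓ∣a → proj₁ good (ℓ∣a , ℓ∣b))
    (λ ℓ∤a → from good⇔ ((λ (ℓ∣a , _) → ℓ∤a ℓ∣a) , λ ℓ⁴∣C → ℓ∤a (ℓ∣a ℓ⁴∣C)))
    where
    ℓ∣a : ℓ ^ 4 ∣ Cℕ a b → ℓ ∣ a
    ℓ∣a ℓ⁴∣C = ∣m^k⇒∣m ℓ-prime 4 (∣m+n∣m⇒∣n (subst (ℓ ∣_) (Cℕ-mod-b a b) (∣-trans (m∣m*n (ℓ ^ 3)) ℓ⁴∣C))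
                                             (∣m⇒∣m*n _ ℓ∣b))

  good⇔ℓ⁴∤C : ∀ {a b} → ¬ ℓ ∣ b → Good ℓ (a , b) ⇔ (¬ ℓ ^ 4 ∣ Cℕ a b)
  good⇔ℓ⁴∤C ℓ∤b = mk⇔ (proj₂ ∘ to good⇔) (λ ¬C → from good⇔ ((λ (_ , ℓ∣b) → ℓ∤b ℓ∣b) , ¬C))

  column-weight : ℕ → ℕ
  column-weight b = if does (ℓ ∣? b) then ℓ ^ 5 else ℓ ^ 2 * r ℓ

  column-count : ∀ b → ∑[ a < ℓ ^ 6 ] 𝟙 (good? ℓ (a , b)) + column-weight b ≡ ℓ ^ 6
  column-count b = count (ℓ ∣? b)
    where
    count : (ℓ∣?b : Dec (ℓ ∣ b)) →
            ∑[ a < ℓ ^ 6 ] 𝟙 (good? ℓ (a , b)) + (if does ℓ∣?b then ℓ ^ 5 else ℓ ^ 2 * r ℓ) ≡ ℓ ^ 6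
    count (yes ℓ∣b) = begin
      ∑[ a < ℓ ^ 6 ] 𝟙 (good? ℓ (a , b)) + ℓ ^ 5                     ≡⟨ cong (_+_ _) multiples ⟨
      ∑[ a < ℓ ^ 6 ] 𝟙 (good? ℓ (a , b)) + ∑[ a < ℓ ^ 6 ] 𝟙 (ℓ ∣? a)
        ≡⟨ ∑-complement (ℓ ^ 6) (λ a → good? ℓ (a , b)) (ℓ ∣?_) (λ a → good⇔ℓ∤a ℓ∣b) ⟩
      ℓ ^ 6                                                          ∎
      where
      open ≡-Reasoning
      multiples : ∑[ a < ℓ ^ 6 ] 𝟙 (ℓ ∣? a) ≡ ℓ ^ 5
      multiples = begin
        ∑[ a < ℓ ^ 6 ] 𝟙 (ℓ ∣? a)      ≡⟨ cong (λ n → ∑[ a < n ] 𝟙 (ℓ ∣? a)) (*-comm ℓ (ℓ ^ 5)) ⟩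
        ∑[ a < ℓ ^ 5 * ℓ ] 𝟙 (ℓ ∣? a)  ≡⟨ ∑-periodic (periodic-if-∣ ℓ) (ℓ ^ 5) ⟩
        ℓ ^ 5 * ∑[ a < ℓ ] 𝟙 (ℓ ∣? a)  ≡⟨ cong (ℓ ^ 5 *_) (trans (∑-if-∣ ℓ 1 0) (cong suc (*-zeroʳ (ℓ ∸ 1)))) ⟩
        ℓ ^ 5 * 1                      ≡⟨ *-identityʳ (ℓ ^ 5) ⟩
        ℓ ^ 5                          ∎
    count (no ℓ∤b) = begin
      ∑[ a < ℓ ^ 6 ] 𝟙 (good? ℓ (a , b)) + ℓ ^ 2 * r ℓ                         ≡⟨ cong (_+_ _) (C-root-count ℓ∤b) ⟨
      ∑[ a < ℓ ^ 6 ] 𝟙 (good? ℓ (a , b)) + ∑[ a < ℓ ^ 6 ] 𝟙 (ℓ ^ 4 ∣? Cℕ a b)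
        ≡⟨ ∑-complement (ℓ ^ 6) (λ a → good? ℓ (a , b)) (λ a → ℓ ^ 4 ∣? Cℕ a b) (λ a → good⇔ℓ⁴∤C ℓ∤b) ⟩
      ℓ ^ 6                                                                    ∎
      where
      open ≡-Reasoning

  good-count : goodCount ℓ + ℓ ^ 5 * (ℓ ^ 5 + (ℓ ∸ 1) * (ℓ ^ 2 * r ℓ)) ≡ ℓ ^ 6 * ℓ ^ 6
  good-count = begin
    goodCount ℓ + ℓ ^ 5 * (ℓ ^ 5 + (ℓ ∸ 1) * (ℓ ^ 2 * r ℓ))
      ≡⟨ cong₂ _+_ (trans (length-filter-cartesianProduct (good? ℓ) id N N) (∑-comm N N _)) weights ⟩
    ∑[ b < N ] ∑[ a < N ] 𝟙 (good? ℓ (a , b)) + ∑ N column-weight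
      ≡⟨ ∑-distrib-+ N (λ b → ∑[ a < N ] 𝟙 (good? ℓ (a , b))) column-weight ⟨
    ∑[ b < N ] (∑[ a < N ] 𝟙 (good? ℓ (a , b)) + column-weight b)
      ≡⟨ ∑-cong N (λ b _ → column-count b) ⟩
    ∑[ b < N ] N
      ≡⟨ ∑-const N N ⟩
    N * N
      ∎
    where
    open ≡-Reasoning
    N : ℕ
    N = ℓ ^ 6
    weights : ℓ ^ 5 * (ℓ ^ 5 + (ℓ ∸ 1) * (ℓ ^ 2 * r ℓ)) ≡ ∑ N column-weight
    weights = sym (begin
      ∑ (ℓ * ℓ ^ 5) column-weight  ≡⟨ cong (λ n → ∑ n column-weight) (*-comm ℓ (ℓ ^ 5)) ⟩
      ∑ (ℓ ^ 5 * ℓ) column-weight  ≡⟨ ∑-periodic (periodic-if-∣ ℓ) (ℓ ^ 5) ⟩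
      ℓ ^ 5 * ∑ ℓ column-weight    ≡⟨ cong (ℓ ^ 5 *_) (∑-if-∣ ℓ (ℓ ^ 5) (ℓ ^ 2 * r ℓ)) ⟩
      ℓ ^ 5 * (ℓ ^ 5 + (ℓ ∸ 1) * (ℓ ^ 2 * r ℓ)) ∎)

lemma4p6 : (ℓ : ℕ) → .{{_ : NonZero ℓ}} → Prime ℓ → ℓ ≢ 2 → ℓ ≢ 3 → ℓ ≢ 5 → 𝔡 ℓ ≡ 1ℚ - (_/_ (+ 1) (ℓ ^ 2) {{m^n≢0 ℓ 2}}) - _/_ (+ (r ℓ * (ℓ ∸ 1))) (ℓ ^ 5) {{m^n≢0 ℓ 5}}
lemma4p6 ℓ ℓ-prime ℓ≢2 ℓ≢3 ℓ≢5 =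
  fraction-identity (goodCount ℓ) (r ℓ * (ℓ ∸ 1)) (ℓ ^ 2) (ℓ ^ 5) (ℓ ^ 12) {{m^n≢0 ℓ 2}} {{m^n≢0 ℓ 5}} {{m^n≢0 ℓ 12}}
    (solve 1 (λ ℓ → ℓ :^ 12 := ℓ :^ 2 :* ℓ :^ 5 :* ℓ :^ 5) refl ℓ)
    (begin
      goodCount ℓ + ℓ ^ 5 * ℓ ^ 5 + r ℓ * (ℓ ∸ 1) * (ℓ ^ 2 * ℓ ^ 5)
        ≡⟨ solve 4 (λ g ℓ ℓ-1 r → g :+ ℓ :^ 5 :* ℓ :^ 5 :+ r :* ℓ-1 :* (ℓ :^ 2 :* ℓ :^ 5)
                                  := g :+ ℓ :^ 5 :* (ℓ :^ 5 :+ ℓ-1 :* (ℓ :^ 2 :* r))) refl (goodCount ℓ) ℓ (ℓ ∸ 1) (r ℓ) ⟩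
      goodCount ℓ + ℓ ^ 5 * (ℓ ^ 5 + (ℓ ∸ 1) * (ℓ ^ 2 * r ℓ))
        ≡⟨ good-count ℓ-prime (ℓ∤ prime[2] ℓ≢2) (ℓ∤ prime[3] ℓ≢3) (ℓ∤ prime[5] ℓ≢5) ⟩
      ℓ ^ 6 * ℓ ^ 6
        ≡⟨ solve 1 (λ ℓ → ℓ :^ 6 :* ℓ :^ 6 := ℓ :^ 12) refl ℓ ⟩
      ℓ ^ 12
        ∎)
  where
  open ≡-Reasoning
  open +-*-Solver
  ℓ∤ : ∀ {q} → Prime q → ℓ ≢ q → ¬ ℓ ∣ q
  ℓ∤ q-prime ℓ≢q ℓ∣q = ℓ≢q (∣prime⇒≡ ℓ-prime q-prime ℓ∣q)
  prime[3] : Prime 3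
  prime[3] = from-yes (prime? 3)
  prime[5] : Prime 5
  prime[5] = from-yes (prime? 5)
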